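{- Let $k$ be an odd integer and let $G$ be a $k$-edge-connected $k$-regular graph. Then $\mathrm{srd}(G)=k$ if and only if $\mathrm{rd}(G)=k$.
   Context: An edge-coloring of $G$ is any map $c:E(G)\to[m]$ (adjacent edges may receive the same color). For distinct vertices $u,v$ of a connected graph $G$, a $u$-$v$-edge-cut is a set $F$ of edges such that $u$ and $v$ lie in different components of $G-F$; a minimum $u$-$v$-edge-cut is one of minimum size among these. A set of edges is rainbow if no two of its edges have the same color. An edge-colored connected graph is rainbow disconnected if for every two distinct vertices $u,v$ there is a rainbow $u$-$v$-edge-cut; $\mathrm{rd}(G)$ is the smallest number of colors of an edge-coloring making $G$ rainbow disconnected. An edge-colored connected graph is strong rainbow disconnected if for every two distinct vertices $u,v$ there is a $u$-$v$-edge-cut that is both rainbow and minimum; $\mathrm{srd}(G)$ is the smallest number of colors of an edge-coloring making $G$ strong rainbow disconnected. -}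

module Defs where

open import Data.Nat using (ℕ; suc; _+_; _*_; _≤_; _<_; _<ᵇ_)
open import Data.Bool using (Bool; true; false; _∧_; if_then_else_)
open import Data.Fin using (Fin; toℕ)
open import Data.List using (List; length; filterᵇ; concatMap; map; allFin)
open import Data.Product using (_×_; _,_; proj₁; proj₂; Σ; ∃)
open import Relation.Binary.PropositionalEquality using (_≡_; _≢_)
open import Relation.Nullary using (¬_)

record Graph : Set where
  field
    n     : ℕ
    adj   : Fin n → Fin n → Bool
    sym   : ∀ i j → adj i j ≡ adj j i
    irrefl : ∀ i → adj i i ≡ false
open Graph public

-- A set of (potential) edges: an edge {i,j} with toℕ i < toℕ j is represented by F i j.
EdgeSet : ℕ → Set
EdgeSet n = Fin n → Fin n → Bool

inF : ∀ {n} → EdgeSet n → Fin n → Fin n → Bool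
inF F i j = if toℕ i <ᵇ toℕ j then F i j else F j i

isEdge : (G : Graph) → Fin (n G) → Fin (n G) → Bool
isEdge G i j = (toℕ i <ᵇ toℕ j) ∧ adj G i j

pairs : ∀ n → List (Fin n × Fin n)
pairs n = concatMap (λ i → map (λ j → (i , j)) (allFin n)) (allFin n)

size : (G : Graph) → EdgeSet (n G) → ℕ
size G F = length (filterᵇ (λ p → isEdge G (proj₁ p) (proj₂ p) ∧ F (proj₁ p) (proj₂ p)) (pairs (n G)))

∅E : ∀ {n} → EdgeSet n
∅E _ _ = false

data Reach (G : Graph) (F : EdgeSet (n G)) : Fin (n G) → Fin (n G) → Set where
  here : ∀ {u} → Reach G F u u
  step : ∀ {u w v} → adj G u w ≡ true → inF F u w ≡ false → Reach G F w v → Reach G F u v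

Connected : Graph → Set
Connected G = ∀ u v → Reach G ∅E u v

IsCut : (G : Graph) → EdgeSet (n G) → Fin (n G) → Fin (n G) → Set
IsCut G F u v = ¬ Reach G F u v

IsMinCut : (G : Graph) → EdgeSet (n G) → Fin (n G) → Fin (n G) → Set
IsMinCut G F u v = IsCut G F u v × (∀ F′ → IsCut G F′ u v → size G F ≤ size G F′)

-- edge-colorings with colors in [m]; the colour of edge {i,j} (toℕ i < toℕ j) is c i j
Coloring : Graph → ℕ → Set
Coloring G m = Fin (n G) → Fin (n G) → Fin m

Rainbow : (G : Graph) {m : ℕ} → Coloring G m → EdgeSet (n G) → Set
Rainbow G c F = ∀ i j i′ j′ →
  isEdge G i j ≡ true → F i j ≡ true →
  isEdge G i′ j′ ≡ true → F i′ j′ ≡ true →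
  c i j ≡ c i′ j′ → (i ≡ i′) × (j ≡ j′)

RainbowDisconnected : (G : Graph) {m : ℕ} → Coloring G m → Set
RainbowDisconnected G c = ∀ u v → u ≢ v → ∃ λ F → IsCut G F u v × Rainbow G c F

StrongRainbowDisconnected : (G : Graph) {m : ℕ} → Coloring G m → Set
StrongRainbowDisconnected G c = ∀ u v → u ≢ v → ∃ λ F → IsMinCut G F u v × Rainbow G c F

rd≡ : Graph → ℕ → Set
rd≡ G k = (Σ (Coloring G k) λ c → RainbowDisconnected G c)
        × (∀ m → m < k → ¬ (Σ (Coloring G m) λ c → RainbowDisconnected G c))

srd≡ : Graph → ℕ → Set
srd≡ G k = (Σ (Coloring G k) λ c → StrongRainbowDisconnected G c)
         × (∀ m → m < k → ¬ (Σ (Coloring G m) λ c → StrongRainbowDisconnected G c))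

degree : (G : Graph) → Fin (n G) → ℕ
degree G v = length (filterᵇ (adj G v) (allFin (n G)))

Regular : Graph → ℕ → Set
Regular G k = ∀ v → degree G v ≡ k

EdgeConnected : Graph → ℕ → Set
EdgeConnected G k = Connected G × (∀ F → size G F < k → ∀ u v → Reach G F u v)

Odd : ℕ → Set
Odd k = ∃ λ t → k ≡ suc (2 * t)

-- A rainbow edge set under an m-colouring has at most m edges, while in a
-- k-edge-connected graph every u-v-edge-cut has at least k edges. Hence, for a
-- colouring with at most k colours, every rainbow cut is a minimum cut, so
-- rainbow and strong rainbow disconnectedness coincide for such colourings,
-- and the optimal value k is attained by one notion iff by the other.
module Submission where

open import Defs
open import Data.Nat using (ℕ; _≤_; _<?_)
open import Data.Nat.Properties using (≮⇒≥; ≤-trans; ≤-refl; <⇒≤)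
open import Data.Bool using (Bool; true; _∧_; T)
open import Data.Bool.Properties using (T?)
open import Data.Fin using (Fin; zero; suc)
open import Data.Fin.Properties using (pigeonhole; <⇒≢)
open import Data.List using (List; []; _∷_; _++_; length; lookup; concatMap; map; allFin; cartesianProduct)
open import Data.List.Properties using (length-map)
open import Data.List.Membership.Propositional.Properties using (∈-lookup)
open import Data.List.Relation.Unary.All as All using (All; []; _∷_)
open import Data.List.Relation.Unary.All.Properties using (all-filter)
open import Data.List.Relation.Unary.AllPairs using (AllPairs; []; _∷_)
import Data.List.Relation.Unary.AllPairs.Properties as AllPairs
open import Data.List.Relation.Unary.Unique.Propositional using (Unique)
import Data.List.Relation.Unary.Unique.Propositional.Properties as Unique
open import Data.Product using (_×_; _,_; proj₁; proj₂)
open import Function using (_on_; _∘_)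
open import Function.Bundles using (_⇔_; mk⇔)
open import Relation.Binary.PropositionalEquality using (_≡_; _≢_; refl; cong; cong₂; subst) renaming (sym to ≡-sym)
open import Relation.Nullary using (yes; no; contradiction)

module _ {A : Set} where

  lookup-injective : ∀ {xs : List A} → Unique xs → ∀ i j → lookup xs i ≡ lookup xs j → i ≡ j
  lookup-injective (_  ∷ _)   zero    zero    _  = refl
  lookup-injective (x∉ ∷ _)   zero    (suc j) eq = contradiction eq (All.lookup x∉ (∈-lookup j))
  lookup-injective (x∉ ∷ _)   (suc i) zero    eq = contradiction (≡-sym eq) (All.lookup x∉ (∈-lookup i))
  lookup-injective (_  ∷ uxs) (suc i) (suc j) eq = cong suc (lookup-injective uxs i j eq)

  injectiveOn⇒Unique-map : ∀ {B : Set} {P : A → Set} {f : A → B} →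
    (∀ {x y} → P x → P y → f x ≡ f y → x ≡ y) →
    ∀ {xs} → All P xs → Unique xs → Unique (map f xs)
  injectiveOn⇒Unique-map {P = P} {f} inj pxs uxs = AllPairs.map⁺ (distinct pxs uxs)
    where
    distinct : ∀ {xs} → All P xs → Unique xs → AllPairs (_≢_ on f) xs
    distinct []         []         = []
    distinct (px ∷ pxs) (x∉ ∷ uxs) =
      All.zipWith (λ (py , x≢y) fx≡fy → x≢y (inj px py fx≡fy)) (pxs , x∉) ∷ distinct pxs uxs

Unique⇒length≤ : ∀ {m} {xs : List (Fin m)} → Unique xs → length xs ≤ m
Unique⇒length≤ {m} {xs} uxs with m <? length xs
... | no  m≮len = ≮⇒≥ m≮len
... | yes m<len with i , j , i<j , eq ← pigeonhole m<len (lookup xs) =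
  contradiction (lookup-injective uxs i j eq) (<⇒≢ i<j)

injectiveOn⇒length≤ : ∀ {A : Set} {P : A → Set} {m} (f : A → Fin m) →
  (∀ {x y} → P x → P y → f x ≡ f y → x ≡ y) →
  ∀ {xs} → All P xs → Unique xs → length xs ≤ m
injectiveOn⇒length≤ f inj {xs} pxs uxs =
  subst (_≤ _) (length-map f xs) (Unique⇒length≤ (injectiveOn⇒Unique-map inj pxs uxs))

concatMap≡cartesianProduct : ∀ {A B : Set} (xs : List A) (ys : List B) →
  concatMap (λ x → map (x ,_) ys) xs ≡ cartesianProduct xs ys
concatMap≡cartesianProduct []       ys = refl
concatMap≡cartesianProduct (x ∷ xs) ys = cong (map (x ,_) ys ++_) (concatMap≡cartesianProduct xs ys)

pairs-Unique : ∀ n → Unique (pairs n)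
pairs-Unique n = subst Unique (≡-sym (concatMap≡cartesianProduct (allFin n) (allFin n)))
  (Unique.cartesianProduct⁺ (Unique.allFin⁺ n) (Unique.allFin⁺ n))

T-∧⇒≡true : ∀ {a b} → T (a ∧ b) → (a ≡ true) × (b ≡ true)
T-∧⇒≡true {true} {true} _ = refl , refl

Rainbow⇒size≤ : (G : Graph) {m : ℕ} (c : Coloring G m) (F : EdgeSet (n G)) →
  Rainbow G c F → size G F ≤ m
Rainbow⇒size≤ G c F rainbow =
  injectiveOn⇒length≤ (λ (i , j) → c i j) inj
    (all-filter (T? ∘ edgeInF) (pairs (n G)))
    (Unique.filter⁺ (T? ∘ edgeInF) (pairs-Unique (n G)))
  where
  edgeInF : Fin (n G) × Fin (n G) → Bool
  edgeInF (i , j) = isEdge G i j ∧ F i j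
  inj : ∀ {p p′} → T (edgeInF p) → T (edgeInF p′) → c (proj₁ p) (proj₂ p) ≡ c (proj₁ p′) (proj₂ p′) → p ≡ p′
  inj {i , j} {i′ , j′} edge edge′ same-colour
    with e , f ← T-∧⇒≡true edge | e′ , f′ ← T-∧⇒≡true edge′
    with i≡i′ , j≡j′ ← rainbow i j i′ j′ e f e′ f′ same-colour = cong₂ _,_ i≡i′ j≡j′

module _ {k : ℕ} {G : Graph} (connectivity : EdgeConnected G k) where

  cut⇒size≥ : ∀ {F u v} → IsCut G F u v → k ≤ size G F
  cut⇒size≥ {F} {u} {v} cut = ≮⇒≥ (λ size<k → cut (proj₂ connectivity F size<k u v))

  rainbowCut⇒minCut : ∀ {m} {c : Coloring G m} {F u v} → m ≤ k →
    Rainbow G c F → IsCut G F u v → IsMinCut G F u v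
  rainbowCut⇒minCut {c = c} {F} m≤k rainbow cut =
    cut , λ F′ cut′ → ≤-trans (≤-trans (Rainbow⇒size≤ G c F rainbow) m≤k) (cut⇒size≥ cut′)

  rd⇒srd : ∀ {m} {c : Coloring G m} → m ≤ k →
    RainbowDisconnected G c → StrongRainbowDisconnected G c
  rd⇒srd m≤k rd u v u≢v with F , cut , rainbow ← rd u v u≢v =
    F , rainbowCut⇒minCut m≤k rainbow cut , rainbow

srd⇒rd : ∀ {G m} {c : Coloring G m} → StrongRainbowDisconnected G c → RainbowDisconnected G c
srd⇒rd srd u v u≢v with F , (cut , _) , rainbow ← srd u v u≢v = F , cut , rainbow

theorem3p10 : (k : ℕ) (G : Graph) → Odd k → EdgeConnected G k → Regular G k →
    srd≡ G k ⇔ rd≡ G k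
theorem3p10 k G _ connectivity _ = mk⇔ srd≡⇒rd≡ rd≡⇒srd≡
  where
  srd≡⇒rd≡ : srd≡ G k → rd≡ G k
  srd≡⇒rd≡ ((c , srd) , fewer-fail) =
    (c , srd⇒rd srd) ,
    λ m m<k (c′ , rd) → fewer-fail m m<k (c′ , rd⇒srd connectivity (<⇒≤ m<k) rd)

  rd≡⇒srd≡ : rd≡ G k → srd≡ G k
  rd≡⇒srd≡ ((c , rd) , fewer-fail) =
    (c , rd⇒srd connectivity ≤-refl rd) ,
    λ m m<k (c′ , srd) → fewer-fail m m<k (c′ , srd⇒rd srd)
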